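{- Let $\mathcal{U}$ be a universe with $1\in\hat{\mathcal{U}}$. Then $1$ is $\mathcal{U}$-invertible if and only if no Left end in $\mathcal{U}$ is a disintegrator.
   Context: Games are short partizan game forms under the misère convention (a player unable to move wins); $0=\{\cdot\mid\cdot\}$, $1=\{0\mid\cdot\}$. $o_L(G)\in\{\mathscr{L},\mathscr{R}\}$ is the winner when Left moves first; outcome classes ordered $\mathscr{L}>\mathscr{N}>\mathscr{R}$, $\mathscr{L}>\mathscr{P}>\mathscr{R}$. For a set of games $\mathcal{A}$, $G\geq_{\mathcal{A}}H$ iff $o(G+X)\geq o(H+X)$ for all $X\in\mathcal{A}$; $\equiv_{\mathcal{A}}$ means both directions. A Left end is a game with no Left options. A universe is a set $\mathcal{U}$ of games closed under sums, conjugates, options, and formation of $\{\mathscr{G}\mid\mathscr{H}\}$ for finite non-empty $\mathscr{G},\mathscr{H}\subseteq\mathcal{U}$. $\hat{\mathcal{U}}$ (Siegel) is the set of augmented forms (game forms whose subpositions may carry Left/Right tombstones) admitting a $\mathcal{U}$-expansion, i.e. whose tombstones can be replaced by $\mathcal{U}$-end-reversible options in $\mathcal{U}$ to recover a game form in $\mathcal{U}$. A form $G$ is $\mathcal{U}$-invertible if $G+H\equiv_{\mathcal{U}}0$ for some $H\in\mathcal{U}$. A game $G$ is a disintegrator if there is a Right option $G^R$ that is not a Left end such that every Left option $G^{RL}$ of $G^R$ satisfies $o_L(G^{RL})=\mathscr{R}$ or is itself a disintegrator. -}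

module Defs where

open import Data.Bool using (Bool; true; false)
open import Data.List using (List; []; _∷_; _++_)
open import Data.List.Relation.Unary.All using (All)
open import Data.List.Relation.Unary.Any using (Any)
open import Data.List.Relation.Binary.Pointwise using (Pointwise)
open import Data.List.Membership.Propositional using (_∈_)
open import Data.Product using (Σ; _×_; ∃; _,_)
open import Data.Sum using (_⊎_)
open import Relation.Binary.PropositionalEquality using (_≡_)
open import Relation.Nullary using (¬_)

data Game : Set where
  ⟨_∣_⟩ : List Game → List Game → Game

Lopts : Game → List Game
Lopts ⟨ L ∣ _ ⟩ = L

Ropts : Game → List Game
Ropts ⟨ _ ∣ R ⟩ = R

0G : Game
0G = ⟨ [] ∣ [] ⟩

1G : Game
1G = ⟨ 0G ∷ [] ∣ [] ⟩

-- Identity of game forms: options are *sets* of forms (order and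
-- repetitions in the lists are irrelevant).
data _≅_ : Game → Game → Set where
  ident : ∀ {GL GR HL HR} →
    All (λ g → Any (λ h → g ≅ h) HL) GL →
    All (λ h → Any (λ g → g ≅ h) GL) HL →
    All (λ g → Any (λ h → g ≅ h) HR) GR →
    All (λ h → Any (λ g → g ≅ h) GR) HR →
    ⟨ GL ∣ GR ⟩ ≅ ⟨ HL ∣ HR ⟩

mutual
  _+_ : Game → Game → Game
  ⟨ GL ∣ GR ⟩ + ⟨ HL ∣ HR ⟩ =
    ⟨ addˡ GL ⟨ HL ∣ HR ⟩ ++ addʳ ⟨ GL ∣ GR ⟩ HL
    ∣ addˡ GR ⟨ HL ∣ HR ⟩ ++ addʳ ⟨ GL ∣ GR ⟩ HR ⟩

  addˡ : List Game → Game → List Game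
  addˡ [] H = []
  addˡ (g ∷ gs) H = (g + H) ∷ addˡ gs H

  addʳ : Game → List Game → List Game
  addʳ G [] = []
  addʳ G (h ∷ hs) = (G + h) ∷ addʳ G hs

infixl 6 _+_

mutual
  conj : Game → Game
  conj ⟨ GL ∣ GR ⟩ = ⟨ conjs GR ∣ conjs GL ⟩

  conjs : List Game → List Game
  conjs [] = []
  conjs (g ∷ gs) = conj g ∷ conjs gs

-- Misère outcomes.
-- leftWinsL G : Left wins G when Left moves first (o_L(G) = 𝓛).
-- leftWinsR G : Left wins G when Right moves first (o_R(G) = 𝓛).
-- A player unable to move wins.

mutual
  leftWinsL : Game → Bool
  leftWinsL ⟨ [] ∣ _ ⟩ = true
  leftWinsL ⟨ g ∷ gs ∣ _ ⟩ = anyR (g ∷ gs)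

  leftWinsR : Game → Bool
  leftWinsR ⟨ _ ∣ [] ⟩ = false
  leftWinsR ⟨ _ ∣ g ∷ gs ⟩ = allL (g ∷ gs)

  anyR : List Game → Bool
  anyR [] = false
  anyR (g ∷ gs) with leftWinsR g
  ... | true = true
  ... | false = anyR gs

  allL : List Game → Bool
  allL [] = true
  allL (g ∷ gs) with leftWinsL g
  ... | true = allL gs
  ... | false = false

data Winner : Set where
  Lw Rw : Winner

toWinner : Bool → Winner
toWinner true = Lw
toWinner false = Rw

oL : Game → Winner
oL G = toWinner (leftWinsL G)

oR : Game → Winner
oR G = toWinner (leftWinsR G)

data Outcome : Set where
  𝓛 𝓝 𝓟 𝓡 : Outcome

outcomeOf : Winner → Winner → Outcome
outcomeOf Lw Lw = 𝓛
outcomeOf Lw Rw = 𝓝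
outcomeOf Rw Lw = 𝓟
outcomeOf Rw Rw = 𝓡

o : Game → Outcome
o G = outcomeOf (oL G) (oR G)

data _≥ₒ_ : Outcome → Outcome → Set where
  𝓛≥ : ∀ {x} → 𝓛 ≥ₒ x
  ≥𝓡 : ∀ {x} → x ≥ₒ 𝓡
  𝓝≥𝓝 : 𝓝 ≥ₒ 𝓝
  𝓟≥𝓟 : 𝓟 ≥ₒ 𝓟

_≥[_]_ : Game → (Game → Set) → Game → Set
G ≥[ 𝒜 ] H = ∀ X → 𝒜 X → o (G + X) ≥ₒ o (H + X)

_≡[_]_ : Game → (Game → Set) → Game → Set
G ≡[ 𝒜 ] H = (G ≥[ 𝒜 ] H) × (H ≥[ 𝒜 ] G)

NonEmpty : List Game → Set
NonEmpty xs = ¬ (xs ≡ [])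

record Universe : Set₁ where
  field
    U        : Game → Set
    -- U is a set of game forms (respects identity of forms)
    U-≅      : ∀ {G H} → U G → G ≅ H → U H
    U-sum    : ∀ {G H} → U G → U H → U (G + H)
    U-conj   : ∀ {G} → U G → U (conj G)
    U-optL   : ∀ {G g} → U G → g ∈ Lopts G → U g
    U-optR   : ∀ {G g} → U G → g ∈ Ropts G → U g
    U-form   : ∀ {Gs Hs} → NonEmpty Gs → NonEmpty Hs →
               All U Gs → All U Hs → U ⟨ Gs ∣ Hs ⟩
open Universe public

LeftEnd : Game → Set
LeftEnd G = Lopts G ≡ []

RightEnd : Game → Set
RightEnd G = Ropts G ≡ []

data Disintegrator : Game → Set where
  disint : ∀ {G GR} → GR ∈ Ropts G → ¬ LeftEnd GR →
    All (λ GRL → oL GRL ≡ Rw ⊎ Disintegrator GRL) (Lopts GR) →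
    Disintegrator G

Invertible : Universe → Game → Set
Invertible 𝒰 G = Σ Game λ H → U 𝒰 H × ((G + H) ≡[ U 𝒰 ] 0G)

-- Augmented forms (Siegel): game forms whose subpositions may carry a
-- Left tombstone and/or a Right tombstone (the two Bool flags).

data Aug : Set where
  aug : (leftTomb rightTomb : Bool) → List Aug → List Aug → Aug

plain : Game → Aug
plain ⟨ GL ∣ GR ⟩ = aug false false (plains GL) (plains GR)
  where
  plains : List Game → List Aug
  plains [] = []
  plains (g ∷ gs) = plain g ∷ plains gs

LEndRev : Universe → Game → Game → Set
LEndRev 𝒰 G GL = ∃ λ GLR → GLR ∈ Ropts GL × LeftEnd GLR × (G ≥[ U 𝒰 ] GLR)

REndRev : Universe → Game → Game → Set
REndRev 𝒰 G GR = ∃ λ GRL → GRL ∈ Lopts GR × RightEnd GRL × (GRL ≥[ U 𝒰 ] G)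

-- Replacement of a tombstone (flag t) by the extra options E of the
-- expanded position G: none if no tombstone, otherwise a non-empty set
-- of U-end-reversible options in U.
FillL : Universe → Bool → Game → List Game → Set
FillL 𝒰 false G E = E ≡ []
FillL 𝒰 true G E = NonEmpty E × All (λ e → U 𝒰 e × LEndRev 𝒰 G e) E

FillR : Universe → Bool → Game → List Game → Set
FillR 𝒰 false G E = E ≡ []
FillR 𝒰 true G E = NonEmpty E × All (λ e → U 𝒰 e × REndRev 𝒰 G e) E

data Expands (𝒰 : Universe) : Aug → Game → Set where
  expand : ∀ {tL tR AL AR GL GR EL ER} →
    Pointwise (Expands 𝒰) AL GL →
    Pointwise (Expands 𝒰) AR GR →
    FillL 𝒰 tL ⟨ GL ++ EL ∣ GR ++ ER ⟩ EL →
    FillR 𝒰 tR ⟨ GL ++ EL ∣ GR ++ ER ⟩ ER →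
    Expands 𝒰 (aug tL tR AL AR) ⟨ GL ++ EL ∣ GR ++ ER ⟩

Uhat : Universe → Aug → Set
Uhat 𝒰 A = Σ Game λ G → Expands 𝒰 A G × U 𝒰 G

module Submission where

-- If Left wins Y moving first, then Right moving first wins 1̄ + Y exactly when
-- Y is a disintegrator: he must move in Y to some Yᴿ that is not a Left end, and Left then
-- loses 1̄ + Yᴿ iff every Yᴿᴸ is lost by Left moving first or is again a disintegrator.
-- The summand 1 + 1̄ of 1 + 1̄ + X only matters once X is an end, and there this fact (or its
-- conjugate) applies, so by induction on X ∈ 𝒰 the sum has the outcome of X and 1̄ inverts 1.
--
-- Let 1 + H ≡ 0 and let D ∈ 𝒰 be a Left end that is a disintegrator. Left moving
-- first wins D, hence 1 + H + D. But whenever 1 + K ≤ 0, Left moving first loses 1 + K + D,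
-- by induction on K: after 1 → 0, the inequality makes K + D no better for Left than 1̄ + D,
-- which Right wins; a move to Kᴸ is answered by some Kᴸᴿ with again 1 + Kᴸᴿ ≤ 0. This
-- reversibility is proved by contradiction: otherwise games distinguishing each 1 + Kᴸᴿ from 0
-- are assembled, with a long sum of copies of 1̄ supplying Right moves in a Left end, into one
-- X ∈ 𝒰 that Left loses moving first but wins after adding 1 + K.

open import Defs
open import Data.Bool using (Bool; true; false; not; _≟_)
open import Data.Bool.Properties using (¬-not; not-injective)
open import Data.List using (List; []; _∷_)
open import Data.List.Relation.Unary.All as All using (All; []; _∷_)
open import Data.List.Relation.Unary.Any using (here; there)
open import Data.List.Relation.Binary.Pointwise using ([]; _∷_)
open import Data.List.Membership.Propositional using (_∈_)
open import Data.List.Membership.Propositional.Properties using (∈-++⁺ˡ; ∈-++⁺ʳ; ∈-++⁻)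
open import Data.Nat using (ℕ; zero; suc; _≤_; _<_; _⊔_; s≤s; s≤s⁻¹) renaming (_+_ to _+ℕ_)
open import Data.Nat.Properties using (≤-trans; <-trans; <-≤-trans; <⇒≤; n<1+n; +-monoˡ-<; +-monoʳ-<; m≤m⊔n; m≤n⊔m)
open import Data.Nat.Induction using (<-wellFounded)
open import Data.Product using (∃-syntax; _×_; _,_; proj₁; proj₂)
open import Data.Sum using (_⊎_; inj₁; inj₂)
open import Function using (_∘_; id; const; _⇔_; mk⇔; Equivalence)
open import Induction.WellFounded using (Acc; acc)
open import Relation.Nullary using (¬_)
open import Relation.Nullary.Decidable using (decidable-stable)
open import Relation.Nullary.Negation using (contradiction; ¬¬-map)
open import Relation.Binary.PropositionalEquality using (_≡_; refl; sym; trans; cong; cong₂; subst; module ≡-Reasoning)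

private variable
  G H Y g : Game
  gs : List Game

∈⇒NonEmpty : g ∈ gs → NonEmpty gs
∈⇒NonEmpty (here _) ()
∈⇒NonEmpty (there _) ()

¬¬-choice : ∀ {A B : Set} {Q : B → Set} {R : A → B → Set} {xs : List A} →
  (∀ {x} → x ∈ xs → ¬ ¬ (∃[ y ] Q y × R x y)) →
  ¬ ¬ (∃[ ys ] All Q ys × (∀ {x} → x ∈ xs → ∃[ y ] y ∈ ys × R x y))
¬¬-choice {xs = []} _ k = k ([] , [] , λ ())
¬¬-choice {xs = _ ∷ _} choose k =
  choose (here refl) λ (y , qy , rxy) →
  ¬¬-choice (choose ∘ there) λ (ys , qys , rys) →
  k (y ∷ ys , qy ∷ qys , λ where
       (here refl) → y , here refl , rxy
       (there mx) → let (y′ , my′ , r) = rys mx in y′ , there my′ , r)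

-- Outcomes

anyR-∈ : g ∈ gs → leftWinsR g ≡ true → anyR gs ≡ true
anyR-∈ {gs = _ ∷ _} (here refl) p rewrite p = refl
anyR-∈ {gs = x ∷ _} (there m) p with leftWinsR x
... | true = refl
... | false = anyR-∈ m p

anyR-witness : ∀ gs → anyR gs ≡ true → ∃[ g ] g ∈ gs × leftWinsR g ≡ true
anyR-witness (x ∷ gs) p with leftWinsR x in eq
... | true = x , here refl , eq
... | false with anyR-witness gs p
...   | g , m , q = g , there m , q

allL-∈ : g ∈ gs → leftWinsL g ≡ false → allL gs ≡ false
allL-∈ {gs = _ ∷ _} (here refl) p rewrite p = refl
allL-∈ {gs = x ∷ _} (there m) p with leftWinsL x
... | true = allL-∈ m p
... | false = refl

allL-witness : ∀ gs → allL gs ≡ false → ∃[ g ] g ∈ gs × leftWinsL g ≡ false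
allL-witness (x ∷ gs) p with leftWinsL x in eq
... | false = x , here refl , eq
... | true with allL-witness gs p
...   | g , m , q = g , there m , q

winsL-end : ∀ G → LeftEnd G → leftWinsL G ≡ true
winsL-end ⟨ [] ∣ _ ⟩ refl = refl

winsL-move : ∀ G → g ∈ Lopts G → leftWinsR g ≡ true → leftWinsL G ≡ true
winsL-move ⟨ _ ∷ _ ∣ _ ⟩ = anyR-∈

winsL⁻ : ∀ G → leftWinsL G ≡ true → LeftEnd G ⊎ ∃[ g ] g ∈ Lopts G × leftWinsR g ≡ true
winsL⁻ ⟨ [] ∣ _ ⟩ p = inj₁ refl
winsL⁻ ⟨ x ∷ L ∣ _ ⟩ p = inj₂ (anyR-witness (x ∷ L) p)

losesL⁻ : ∀ G → leftWinsL G ≡ false → g ∈ Lopts G → leftWinsR g ≡ false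
losesL⁻ {g} G p m with leftWinsR g in eq
... | false = refl
... | true with () ← trans (sym (winsL-move G m eq)) p

losesL : ∀ G → ¬ LeftEnd G → (∀ {g} → g ∈ Lopts G → leftWinsR g ≡ false) → leftWinsL G ≡ false
losesL G ne f = ¬-not refute
  where
  refute : ¬ leftWinsL G ≡ true
  refute p with winsL⁻ G p
  ... | inj₁ e = ne e
  ... | inj₂ (_ , m , q) with () ← trans (sym q) (f m)

losesR-end : ∀ G → RightEnd G → leftWinsR G ≡ false
losesR-end ⟨ _ ∣ [] ⟩ refl = refl

losesR-move : ∀ G → g ∈ Ropts G → leftWinsL g ≡ false → leftWinsR G ≡ false
losesR-move ⟨ _ ∣ _ ∷ _ ⟩ = allL-∈

losesR⁻ : ∀ G → leftWinsR G ≡ false → RightEnd G ⊎ ∃[ g ] g ∈ Ropts G × leftWinsL g ≡ false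
losesR⁻ ⟨ _ ∣ [] ⟩ p = inj₁ refl
losesR⁻ ⟨ _ ∣ x ∷ R ⟩ p = inj₂ (allL-witness (x ∷ R) p)

winsR⁻ : ∀ G → leftWinsR G ≡ true → g ∈ Ropts G → leftWinsL g ≡ true
winsR⁻ {g} G p m with leftWinsL g in eq
... | true = refl
... | false with () ← trans (sym p) (losesR-move G m eq)

winsR : ∀ G → ¬ RightEnd G → (∀ {g} → g ∈ Ropts G → leftWinsL g ≡ true) → leftWinsR G ≡ true
winsR G ne f = ¬-not refute
  where
  refute : ¬ leftWinsR G ≡ false
  refute p with losesR⁻ G p
  ... | inj₁ e = ne e
  ... | inj₂ (_ , m , q) with () ← trans (sym (f m)) q

∈-addˡ : g ∈ gs → g + H ∈ addˡ gs H
∈-addˡ (here refl) = here refl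
∈-addˡ (there m) = there (∈-addˡ m)

∈-addʳ : g ∈ gs → G + g ∈ addʳ G gs
∈-addʳ (here refl) = here refl
∈-addʳ (there m) = there (∈-addʳ m)

data SumOption (G H : Game) (gs hs : List Game) : Game → Set where
  inˡ : g ∈ gs → SumOption G H gs hs (g + H)
  inʳ : g ∈ hs → SumOption G H gs hs (G + g)

addˡ⁻ : ∀ {x} gs → x ∈ addˡ gs H → ∃[ g ] g ∈ gs × x ≡ g + H
addˡ⁻ (g ∷ _) (here refl) = g , here refl , refl
addˡ⁻ (_ ∷ gs) (there m) with addˡ⁻ gs m
... | g , m′ , refl = g , there m′ , refl

addʳ⁻ : ∀ {x} gs → x ∈ addʳ G gs → ∃[ g ] g ∈ gs × x ≡ G + g
addʳ⁻ (g ∷ _) (here refl) = g , here refl , refl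
addʳ⁻ (_ ∷ gs) (there m) with addʳ⁻ gs m
... | g , m′ , refl = g , there m′ , refl

+-Lˡ : ∀ G H → g ∈ Lopts G → g + H ∈ Lopts (G + H)
+-Lˡ ⟨ _ ∣ _ ⟩ ⟨ _ ∣ _ ⟩ m = ∈-++⁺ˡ (∈-addˡ m)

+-Lʳ : ∀ G H → g ∈ Lopts H → G + g ∈ Lopts (G + H)
+-Lʳ ⟨ GL ∣ _ ⟩ ⟨ _ ∣ _ ⟩ m = ∈-++⁺ʳ (addˡ GL _) (∈-addʳ m)

+-Rˡ : ∀ G H → g ∈ Ropts G → g + H ∈ Ropts (G + H)
+-Rˡ ⟨ _ ∣ _ ⟩ ⟨ _ ∣ _ ⟩ m = ∈-++⁺ˡ (∈-addˡ m)

+-Rʳ : ∀ G H → g ∈ Ropts H → G + g ∈ Ropts (G + H)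
+-Rʳ ⟨ _ ∣ GR ⟩ ⟨ _ ∣ _ ⟩ m = ∈-++⁺ʳ (addˡ GR _) (∈-addʳ m)

+-L⁻ : ∀ G H {x} → x ∈ Lopts (G + H) → SumOption G H (Lopts G) (Lopts H) x
+-L⁻ ⟨ GL ∣ _ ⟩ ⟨ HL ∣ _ ⟩ m with ∈-++⁻ (addˡ GL _) m
... | inj₁ m′ with addˡ⁻ GL m′
...   | _ , mg , refl = inˡ mg
+-L⁻ ⟨ GL ∣ _ ⟩ ⟨ HL ∣ _ ⟩ m | inj₂ m′ with addʳ⁻ HL m′
...   | _ , mh , refl = inʳ mh

+-R⁻ : ∀ G H {x} → x ∈ Ropts (G + H) → SumOption G H (Ropts G) (Ropts H) x
+-R⁻ ⟨ _ ∣ GR ⟩ ⟨ _ ∣ HR ⟩ m with ∈-++⁻ (addˡ GR _) m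
... | inj₁ m′ with addˡ⁻ GR m′
...   | _ , mg , refl = inˡ mg
+-R⁻ ⟨ _ ∣ GR ⟩ ⟨ _ ∣ HR ⟩ m | inj₂ m′ with addʳ⁻ HR m′
...   | _ , mh , refl = inʳ mh

+-LeftEnd : ∀ G H → LeftEnd G → LeftEnd H → LeftEnd (G + H)
+-LeftEnd ⟨ [] ∣ _ ⟩ ⟨ [] ∣ _ ⟩ refl refl = refl

+-RightEnd : ∀ G H → RightEnd G → RightEnd H → RightEnd (G + H)
+-RightEnd ⟨ _ ∣ [] ⟩ ⟨ _ ∣ [] ⟩ refl refl = refl

+-LeftEnd⁻ʳ : ∀ G H → LeftEnd (G + H) → LeftEnd H
+-LeftEnd⁻ʳ ⟨ [] ∣ _ ⟩ ⟨ [] ∣ _ ⟩ _ = refl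
+-LeftEnd⁻ʳ ⟨ _ ∷ _ ∣ _ ⟩ ⟨ _ ∣ _ ⟩ ()
+-LeftEnd⁻ʳ ⟨ [] ∣ _ ⟩ ⟨ _ ∷ _ ∣ _ ⟩ ()

mutual
  +-identityˡ : ∀ G → 0G + G ≡ G
  +-identityˡ ⟨ L ∣ R ⟩ = cong₂ ⟨_∣_⟩ (addʳ-identityˡ L) (addʳ-identityˡ R)

  addʳ-identityˡ : ∀ gs → addʳ 0G gs ≡ gs
  addʳ-identityˡ [] = refl
  addʳ-identityˡ (g ∷ gs) = cong₂ _∷_ (+-identityˡ g) (addʳ-identityˡ gs)

mutual
  height : Game → ℕ
  height ⟨ L ∣ R ⟩ = suc (heights L ⊔ heights R)

  heights : List Game → ℕ
  heights [] = 0
  heights (g ∷ gs) = height g ⊔ heights gs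

heights-∈ : g ∈ gs → height g ≤ heights gs
heights-∈ {gs = x ∷ gs} (here refl) = m≤m⊔n (height x) (heights gs)
heights-∈ {gs = x ∷ gs} (there m) = ≤-trans (heights-∈ m) (m≤n⊔m (height x) (heights gs))

height-L : ∀ G → g ∈ Lopts G → height g < height G
height-L ⟨ L ∣ R ⟩ m = s≤s (≤-trans (heights-∈ m) (m≤m⊔n (heights L) (heights R)))

height-R : ∀ G → g ∈ Ropts G → height g < height G
height-R ⟨ L ∣ R ⟩ m = s≤s (≤-trans (heights-∈ m) (m≤n⊔m (heights L) (heights R)))

mutual
  leftWinsL-conj : ∀ G → leftWinsL (conj G) ≡ not (leftWinsR G)
  leftWinsL-conj ⟨ _ ∣ [] ⟩ = refl
  leftWinsL-conj ⟨ _ ∣ x ∷ R ⟩ = anyR-conjs (x ∷ R)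

  leftWinsR-conj : ∀ G → leftWinsR (conj G) ≡ not (leftWinsL G)
  leftWinsR-conj ⟨ [] ∣ _ ⟩ = refl
  leftWinsR-conj ⟨ x ∷ L ∣ _ ⟩ = allL-conjs (x ∷ L)

  anyR-conjs : ∀ gs → anyR (conjs gs) ≡ not (allL gs)
  anyR-conjs [] = refl
  anyR-conjs (g ∷ gs) rewrite leftWinsR-conj g with leftWinsL g
  ... | true = anyR-conjs gs
  ... | false = refl

  allL-conjs : ∀ gs → allL (conjs gs) ≡ not (anyR gs)
  allL-conjs [] = refl
  allL-conjs (g ∷ gs) rewrite leftWinsL-conj g with leftWinsR g
  ... | true = refl
  ... | false = allL-conjs gs

∈-conjs : g ∈ gs → conj g ∈ conjs gs
∈-conjs (here refl) = here refl
∈-conjs (there m) = there (∈-conjs m)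

conj-Ropts : ∀ G → g ∈ Lopts G → conj g ∈ Ropts (conj G)
conj-Ropts ⟨ _ ∣ _ ⟩ = ∈-conjs

All-Lopts-conj : ∀ {P : Game → Set} G → (∀ {g} → g ∈ Ropts G → P (conj g)) → All P (Lopts (conj G))
All-Lopts-conj {P} ⟨ _ ∣ R ⟩ = all-conjs R
  where
  all-conjs : ∀ gs → (∀ {g} → g ∈ gs → P (conj g)) → All P (conjs gs)
  all-conjs [] f = []
  all-conjs (g ∷ gs) f = f (here refl) ∷ all-conjs gs (f ∘ there)

conj-LeftEnd : ∀ G → RightEnd G → LeftEnd (conj G)
conj-LeftEnd ⟨ _ ∣ [] ⟩ refl = refl

conj-LeftEnd⁻ : ∀ G → LeftEnd (conj G) → RightEnd G
conj-LeftEnd⁻ ⟨ _ ∣ [] ⟩ _ = refl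

≥ₒ-reflexive : ∀ {x y} → x ≡ y → x ≥ₒ y
≥ₒ-reflexive {𝓛} refl = 𝓛≥
≥ₒ-reflexive {𝓝} refl = 𝓝≥𝓝
≥ₒ-reflexive {𝓟} refl = 𝓟≥𝓟
≥ₒ-reflexive {𝓡} refl = ≥𝓡

Implies : Bool → Bool → Set
Implies a b = a ≡ true → b ≡ true

outcomeOf-≥ₒ : ∀ a b c d →
  outcomeOf (toWinner a) (toWinner b) ≥ₒ outcomeOf (toWinner c) (toWinner d) ⇔ (Implies c a × Implies d b)
outcomeOf-≥ₒ a b c d = mk⇔ (sound a b c d) (complete a b c d)
  where
  sound : ∀ a b c d → outcomeOf (toWinner a) (toWinner b) ≥ₒ outcomeOf (toWinner c) (toWinner d) → Implies c a × Implies d b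
  sound true  true  _     _     _ = const refl , const refl
  sound true  false _     false _ = const refl , id
  sound false true  false _     _ = id , const refl
  sound false false false false _ = id , id
  sound true  false true  true  ()
  sound true  false false true  ()
  sound false true  true  true  ()
  sound false true  true  false ()
  sound false false true  true  ()
  sound false false true  false ()
  sound false false false true  ()

  complete : ∀ a b c d → Implies c a × Implies d b → outcomeOf (toWinner a) (toWinner b) ≥ₒ outcomeOf (toWinner c) (toWinner d)
  complete true  true  _     _     _ = 𝓛≥
  complete _     _     false false _ = ≥𝓡
  complete true  false true  false _ = 𝓝≥𝓝
  complete false true  false true  _ = 𝓟≥𝓟
  complete _     false _     true  (_ , d⇒b) with () ← d⇒b refl
  complete false _     true  _     (c⇒a , _) with () ← c⇒a refl

o-≥ₒ⇔ : ∀ G H → o G ≥ₒ o H ⇔ (Implies (leftWinsL H) (leftWinsL G) × Implies (leftWinsR H) (leftWinsR G))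
o-≥ₒ⇔ G H = outcomeOf-≥ₒ (leftWinsL G) (leftWinsR G) (leftWinsL H) (leftWinsR H)

≥ₒ-leftWinsL : ∀ G H → o G ≥ₒ o H → Implies (leftWinsL H) (leftWinsL G)
≥ₒ-leftWinsL G H = proj₁ ∘ Equivalence.to (o-≥ₒ⇔ G H)

-- 1̄ and disintegrators

1̄ : Game
1̄ = conj 1G

oL-Rw-or : ∀ {P : Set} g → (leftWinsL g ≡ true → P) → oL g ≡ Rw ⊎ P
oL-Rw-or g f with leftWinsL g
... | true = inj₂ (f refl)
... | false = inj₁ refl

leftWins-0+ : ∀ X → leftWinsL (0G + X) ≡ leftWinsL X × leftWinsR (0G + X) ≡ leftWinsR X
leftWins-0+ X rewrite +-identityˡ X = refl , refl

winsL-1+ : ∀ X → leftWinsR X ≡ true → leftWinsL (1G + X) ≡ true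
winsL-1+ X p = winsL-move (1G + X) (+-Lˡ 1G X (here refl)) (trans (proj₂ (leftWins-0+ X)) p)

losesR-1̄+ : ∀ X → leftWinsL X ≡ false → leftWinsR (1̄ + X) ≡ false
losesR-1̄+ X p = losesR-move (1̄ + X) (+-Rˡ 1̄ X (here refl)) (trans (proj₁ (leftWins-0+ X)) p)

mutual
  disintegrator-losesR-1̄ : Disintegrator Y → leftWinsR (1̄ + Y) ≡ false
  disintegrator-losesR-1̄ {Y} (disint {GR = Yᴿ} mR notEnd options) =
    losesR-move (1̄ + Y) (+-Rʳ 1̄ Y mR)
      (losesL (1̄ + Yᴿ) (notEnd ∘ +-LeftEnd⁻ʳ 1̄ Yᴿ) λ mL → reply (+-L⁻ 1̄ Yᴿ mL))
    where
    reply : ∀ {x} → SumOption 1̄ Yᴿ [] (Lopts Yᴿ) x → leftWinsR x ≡ false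
    reply (inʳ m) = All.lookup (options-losesR-1̄ options) m

  options-losesR-1̄ : All (λ g → oL g ≡ Rw ⊎ Disintegrator g) gs → All (λ g → leftWinsR (1̄ + g) ≡ false) gs
  options-losesR-1̄ [] = []
  options-losesR-1̄ {g ∷ _} (inj₁ lost ∷ rest) = losesR-1̄+ g (toWinner-Rw lost) ∷ options-losesR-1̄ rest
    where
    toWinner-Rw : ∀ {b} → toWinner b ≡ Rw → b ≡ false
    toWinner-Rw {false} _ = refl
  options-losesR-1̄ (inj₂ d ∷ rest) = disintegrator-losesR-1̄ d ∷ options-losesR-1̄ rest

1̄-losesR⇒disintegrator : ∀ Y → leftWinsL Y ≡ true → leftWinsR (1̄ + Y) ≡ false → Disintegrator Y
1̄-losesR⇒disintegrator Y = go Y (<-wellFounded (height Y))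
  where
  go : ∀ Y → Acc _<_ (height Y) → leftWinsL Y ≡ true → leftWinsR (1̄ + Y) ≡ false → Disintegrator Y
  go Y (acc rec) wins loses with losesR⁻ (1̄ + Y) loses
  ... | inj₁ end = contradiction end (∈⇒NonEmpty (+-Rˡ 1̄ Y (here refl)))
  ... | inj₂ (_ , mw , lost) with +-R⁻ 1̄ Y mw
  ...   | inˡ (here refl) with () ← trans (sym (trans (proj₁ (leftWins-0+ Y)) wins)) lost
  ...   | inʳ {Yᴿ} mR = disint mR notEnd (All.tabulate classify)
    where
    notEnd : ¬ LeftEnd Yᴿ
    notEnd end with () ← trans (sym (winsL-end (1̄ + Yᴿ) (+-LeftEnd 1̄ Yᴿ refl end))) lost
    classify : ∀ {g} → g ∈ Lopts Yᴿ → oL g ≡ Rw ⊎ Disintegrator g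
    classify {g} mL = oL-Rw-or g λ winsg →
      go g (rec (<-trans (height-L Yᴿ mL) (height-R Y mR))) winsg
         (losesL⁻ (1̄ + Yᴿ) lost (+-Lʳ 1̄ Yᴿ mL))

1-winsL⇒conj-disintegrator : ∀ Y → leftWinsR Y ≡ false → leftWinsL (1G + Y) ≡ true → Disintegrator (conj Y)
1-winsL⇒conj-disintegrator Y = go Y (<-wellFounded (height Y))
  where
  go : ∀ Y → Acc _<_ (height Y) → leftWinsR Y ≡ false → leftWinsL (1G + Y) ≡ true → Disintegrator (conj Y)
  go Y (acc rec) loses wins with winsL⁻ (1G + Y) wins
  ... | inj₁ end = contradiction end (∈⇒NonEmpty (+-Lˡ 1G Y (here refl)))
  ... | inj₂ (_ , mw , won) with +-L⁻ 1G Y mw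
  ...   | inˡ (here refl) with () ← trans (sym won) (trans (proj₂ (leftWins-0+ Y)) loses)
  ...   | inʳ {Yᴸ} mL = disint (conj-Ropts Y mL) notEnd (All-Lopts-conj Yᴸ classify)
    where
    notEnd : ¬ LeftEnd (conj Yᴸ)
    notEnd end with () ← trans (sym won) (losesR-end (1G + Yᴸ) (+-RightEnd 1G Yᴸ refl (conj-LeftEnd⁻ Yᴸ end)))
    classify : ∀ {g} → g ∈ Ropts Yᴸ → oL (conj g) ≡ Rw ⊎ Disintegrator (conj g)
    classify {g} mR = oL-Rw-or (conj g) λ winsg →
      go g (rec (<-trans (height-R Yᴸ mR) (height-L Y mL)))
         (not-injective (trans (sym (leftWinsL-conj g)) winsg))
         (winsR⁻ (1G + Yᴸ) won (+-Rʳ 1G Yᴸ mR))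

nondisintegrator-winsR-1̄ : ∀ Y → leftWinsL Y ≡ true → ¬ Disintegrator Y → leftWinsR (1̄ + Y) ≡ true
nondisintegrator-winsR-1̄ Y wins nd with leftWinsR (1̄ + Y) in eq
... | true = refl
... | false = contradiction (1̄-losesR⇒disintegrator Y wins eq) nd

conj-nondisintegrator-losesL-1 : ∀ Y → leftWinsR Y ≡ false → ¬ Disintegrator (conj Y) → leftWinsL (1G + Y) ≡ false
conj-nondisintegrator-losesL-1 Y loses nd with leftWinsL (1G + Y) in eq
... | false = refl
... | true = contradiction (1-winsL⇒conj-disintegrator Y loses eq) nd

module Sufficiency (𝒰 : Universe) (no-disintegrator : ∀ G → U 𝒰 G → LeftEnd G → ¬ Disintegrator G) where

  mutual
    winsL-1+1̄ : ∀ X → Acc _<_ (height X) → U 𝒰 X → leftWinsL X ≡ true → leftWinsL (1G + 1̄ + X) ≡ true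
    winsL-1+1̄ X (acc rec) uX wins with winsL⁻ X wins
    ... | inj₁ end = winsL-move (1G + 1̄ + X) (+-Lˡ (1G + 1̄) X (here refl))
                       (nondisintegrator-winsR-1̄ X wins (no-disintegrator X uX end))
    ... | inj₂ (Xᴸ , mL , won) = winsL-move (1G + 1̄ + X) (+-Lʳ (1G + 1̄) X mL)
                                   (winsR-1+1̄ Xᴸ (rec (height-L X mL)) (U-optL 𝒰 uX mL) won)

    winsR-1+1̄ : ∀ X → Acc _<_ (height X) → U 𝒰 X → leftWinsR X ≡ true → leftWinsR (1G + 1̄ + X) ≡ true
    winsR-1+1̄ X (acc rec) uX wins =
      winsR (1G + 1̄ + X) (∈⇒NonEmpty (+-Rˡ (1G + 1̄) X (here refl))) λ mw → reply (+-R⁻ (1G + 1̄) X mw)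
      where
      reply : ∀ {w} → SumOption (1G + 1̄) X (Ropts (1G + 1̄)) (Ropts X) w → leftWinsL w ≡ true
      reply (inˡ (here refl)) = winsL-1+ X wins
      reply (inʳ mR) = winsL-1+1̄ _ (rec (height-R X mR)) (U-optR 𝒰 uX mR) (winsR⁻ X wins mR)

  mutual
    losesL-1+1̄ : ∀ X → Acc _<_ (height X) → U 𝒰 X → leftWinsL X ≡ false → leftWinsL (1G + 1̄ + X) ≡ false
    losesL-1+1̄ X (acc rec) uX loses =
      losesL (1G + 1̄ + X) (∈⇒NonEmpty (+-Lˡ (1G + 1̄) X (here refl))) λ mw → reply (+-L⁻ (1G + 1̄) X mw)
      where
      reply : ∀ {w} → SumOption (1G + 1̄) X (Lopts (1G + 1̄)) (Lopts X) w → leftWinsR w ≡ false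
      reply (inˡ (here refl)) = losesR-1̄+ X loses
      reply (inʳ mL) = losesR-1+1̄ _ (rec (height-L X mL)) (U-optL 𝒰 uX mL) (losesL⁻ X loses mL)

    losesR-1+1̄ : ∀ X → Acc _<_ (height X) → U 𝒰 X → leftWinsR X ≡ false → leftWinsR (1G + 1̄ + X) ≡ false
    losesR-1+1̄ X (acc rec) uX loses with losesR⁻ X loses
    ... | inj₁ end = losesR-move (1G + 1̄ + X) (+-Rˡ (1G + 1̄) X (here refl))
                       (conj-nondisintegrator-losesL-1 X loses
                          (no-disintegrator (conj X) (U-conj 𝒰 uX) (conj-LeftEnd X end)))
    ... | inj₂ (Xᴿ , mR , lost) = losesR-move (1G + 1̄ + X) (+-Rʳ (1G + 1̄) X mR)
                                    (losesL-1+1̄ Xᴿ (rec (height-R X mR)) (U-optR 𝒰 uX mR) lost)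

  leftWinsL-1+1̄ : ∀ X → U 𝒰 X → leftWinsL (1G + 1̄ + X) ≡ leftWinsL X
  leftWinsL-1+1̄ X uX with leftWinsL X in eq
  ... | true = winsL-1+1̄ X (<-wellFounded _) uX eq
  ... | false = losesL-1+1̄ X (<-wellFounded _) uX eq

  leftWinsR-1+1̄ : ∀ X → U 𝒰 X → leftWinsR (1G + 1̄ + X) ≡ leftWinsR X
  leftWinsR-1+1̄ X uX with leftWinsR X in eq
  ... | true = winsR-1+1̄ X (<-wellFounded _) uX eq
  ... | false = losesR-1+1̄ X (<-wellFounded _) uX eq

  1+1̄≡0 : (1G + 1̄) ≡[ U 𝒰 ] 0G
  1+1̄≡0 = (λ X uX → ≥ₒ-reflexive (same-outcome X uX)) , (λ X uX → ≥ₒ-reflexive (sym (same-outcome X uX)))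
    where
    same-outcome : ∀ X → U 𝒰 X → o (1G + 1̄ + X) ≡ o (0G + X)
    same-outcome X uX = begin
      o (1G + 1̄ + X)  ≡⟨ cong₂ outcomeOf (cong toWinner (leftWinsL-1+1̄ X uX)) (cong toWinner (leftWinsR-1+1̄ X uX)) ⟩
      o X             ≡⟨ cong o (sym (+-identityˡ X)) ⟩
      o (0G + X)      ∎
      where open ≡-Reasoning

-- Tallies of 1̄

tally : ℕ → Game
tally zero = 0G
tally (suc m) = 1̄ + tally m

tally-LeftEnd : ∀ m → LeftEnd (tally m)
tally-LeftEnd zero = refl
tally-LeftEnd (suc m) = +-LeftEnd 1̄ (tally m) refl (tally-LeftEnd m)

tally-Ropts : ∀ m {z} → z ∈ Ropts (tally (suc m)) → z ≡ tally m
tally-Ropts zero mz with +-R⁻ 1̄ 0G mz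
... | inˡ (here refl) = refl
tally-Ropts (suc m) mz with +-R⁻ 1̄ (tally (suc m)) mz
... | inˡ (here refl) = +-identityˡ (tally (suc m))
... | inʳ mz′ = cong (1̄ +_) (tally-Ropts m mz′)

private
  mutual
    winsL-+tally : ∀ Y m → Acc _<_ (height Y +ℕ m) → height Y ≤ m → leftWinsL (Y + tally m) ≡ true
    winsL-+tally Y@(⟨ [] ∣ _ ⟩) m _ _ = winsL-end (Y + tally m) (+-LeftEnd Y (tally m) refl (tally-LeftEnd m))
    winsL-+tally Y@(⟨ _ ∷ _ ∣ _ ⟩) m (acc rec) h =
      winsL-move (Y + tally m) (+-Lˡ Y (tally m) (here refl))
        (winsR-+tally _ m (rec (+-monoˡ-< m lower)) (<-≤-trans lower h))
      where
      lower = height-L Y (here refl)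

    winsR-+tally : ∀ Y m → Acc _<_ (height Y +ℕ m) → height Y < m → leftWinsR (Y + tally m) ≡ true
    winsR-+tally Y (suc m) (acc rec) h =
      winsR (Y + tally (suc m)) (∈⇒NonEmpty (+-Rʳ Y (tally (suc m)) (+-Rˡ 1̄ (tally m) (here refl))))
        λ mw → reply (+-R⁻ Y (tally (suc m)) mw)
      where
      reply : ∀ {w} → SumOption Y (tally (suc m)) (Ropts Y) (Ropts (tally (suc m))) w → leftWinsL w ≡ true
      reply (inˡ mR) = winsL-+tally _ (suc m) (rec (+-monoˡ-< (suc m) (height-R Y mR))) (<⇒≤ (<-trans (height-R Y mR) h))
      reply (inʳ mz) rewrite tally-Ropts m mz = winsL-+tally Y m (rec (+-monoʳ-< (height Y) (n<1+n m))) (s≤s⁻¹ h)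

-- Left cannot move in tally m, but Right can keep moving there for m turns: Left runs out of
-- moves in Y first, and wins.
leftWinsL-+tally : ∀ Y m → height Y ≤ m → leftWinsL (Y + tally m) ≡ true
leftWinsL-+tally Y m = winsL-+tally Y m (<-wellFounded _)

leftWinsR-+tally : ∀ Y m → height Y < m → leftWinsR (Y + tally m) ≡ true
leftWinsR-+tally Y m = winsR-+tally Y m (<-wellFounded _)

answer : ℕ → Game → Game
answer m W = ⟨ tally m ∷ [] ∣ W ∷ [] ⟩

answer-winsR : ∀ Y m W → height Y ≤ m → leftWinsL (Y + W) ≡ true → leftWinsR (Y + answer m W) ≡ true
answer-winsR Y m W h won =
  winsR (Y + answer m W) (∈⇒NonEmpty (+-Rʳ Y (answer m W) (here refl))) λ mw → reply (+-R⁻ Y (answer m W) mw)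
  where
  reply : ∀ {w} → SumOption Y (answer m W) (Ropts Y) (W ∷ []) w → leftWinsL w ≡ true
  reply (inˡ {Yᴿ} mR) = winsL-move (Yᴿ + answer m W) (+-Lʳ Yᴿ (answer m W) (here refl))
                          (leftWinsR-+tally Yᴿ m (<-≤-trans (height-R Y mR) h))
  reply (inʳ (here refl)) = won

probe : ℕ → List Game → Game
probe m Vs = ⟨ 1G ∷ Vs ∣ tally m ∷ [] ⟩

probe-losesL : ∀ m Vs → All (λ v → leftWinsR v ≡ false) Vs → leftWinsL (probe m Vs) ≡ false
probe-losesL m Vs losing = losesL (probe m Vs) (λ ()) λ where
  (here refl) → refl
  (there mv) → All.lookup losing mv

probe-winsR : ∀ Y m Vs → height Y ≤ m →
  (∀ {y} → y ∈ Ropts Y → ∃[ v ] v ∈ Vs × leftWinsR (y + v) ≡ true) → leftWinsR (Y + probe m Vs) ≡ true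
probe-winsR Y m Vs h answers =
  winsR (Y + probe m Vs) (∈⇒NonEmpty (+-Rʳ Y (probe m Vs) (here refl))) λ mw → reply (+-R⁻ Y (probe m Vs) mw)
  where
  reply : ∀ {w} → SumOption Y (probe m Vs) (Ropts Y) (tally m ∷ []) w → leftWinsL w ≡ true
  reply (inˡ {Yᴿ} mR) with answers mR
  ... | _ , mv , won = winsL-move (Yᴿ + probe m Vs) (+-Lʳ Yᴿ (probe m Vs) (there mv)) won
  reply (inʳ (here refl)) = leftWinsL-+tally Y m h

module Necessity (𝒰 : Universe) (1∈U : U 𝒰 1G) where

  0∈U : U 𝒰 0G
  0∈U = U-optL 𝒰 1∈U (here refl)

  tally∈U : ∀ m → U 𝒰 (tally m)
  tally∈U zero = 0∈U
  tally∈U (suc m) = U-sum 𝒰 (U-conj 𝒰 1∈U) (tally∈U m)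

  ≰0⇒distinguisher : ∀ Y → ¬ (0G ≥[ U 𝒰 ] Y) →
    ¬ ¬ (∃[ W ] U 𝒰 W × leftWinsL W ≡ false × leftWinsL (Y + W) ≡ true)
  ≰0⇒distinguisher Y ≰0 none = ≰0 λ X uX → Equivalence.from (o-≥ₒ⇔ (0G + X) (Y + X)) (leftFirst X uX , rightFirst X uX)
    where
    leftFirst : ∀ X → U 𝒰 X → Implies (leftWinsL (Y + X)) (leftWinsL (0G + X))
    leftFirst X uX won with leftWinsL (0G + X) in eq
    ... | true = refl
    ... | false = contradiction (X , uX , trans (sym (proj₁ (leftWins-0+ X))) eq , won) none

    rightFirst : ∀ X → U 𝒰 X → Implies (leftWinsR (Y + X)) (leftWinsR (0G + X))
    rightFirst X uX won with leftWinsR (0G + X) in eq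
    ... | true = refl
    ... | false = contradiction (W , uW , lostW , wonW) none
      where
      -- Left moving first in W must go to X, where Right then moves first.
      W = ⟨ X ∷ [] ∣ 0G ∷ [] ⟩
      uW : U 𝒰 W
      uW = U-form 𝒰 (λ ()) (λ ()) (uX ∷ []) (0∈U ∷ [])
      lostW : leftWinsL W ≡ false
      lostW = losesL W (λ ()) λ where (here refl) → trans (sym (proj₂ (leftWins-0+ X))) eq
      wonW : leftWinsL (Y + W) ≡ true
      wonW = winsL-move (Y + W) (+-Lʳ Y W (here refl)) won

  1+≤0-reversible : ∀ K {Kᴸ} → 0G ≥[ U 𝒰 ] (1G + K) → Kᴸ ∈ Lopts K →
    ¬ ¬ (∃[ A ] A ∈ Ropts Kᴸ × 0G ≥[ U 𝒰 ] (1G + A))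
  1+≤0-reversible K {Kᴸ} ≤0 mL none = ¬¬-choice answerTo refute
    where
    -- Every 1 + A below has height less than m, so the tallies in the games built here outlast it.
    m : ℕ
    m = height (1G + K)

    h : height (1G + Kᴸ) ≤ m
    h = <⇒≤ (height-L (1G + K) (+-Lʳ 1G K mL))

    answerTo : ∀ {y} → y ∈ Ropts (1G + Kᴸ) →
      ¬ ¬ (∃[ v ] (U 𝒰 v × leftWinsR v ≡ false) × leftWinsR (y + v) ≡ true)
    answerTo my with +-R⁻ 1G Kᴸ my
    ... | inʳ {A} mA = ¬¬-map build (≰0⇒distinguisher (1G + A) λ ≤0A → none (A , mA , ≤0A))
      where
      build : ∃[ W ] U 𝒰 W × leftWinsL W ≡ false × leftWinsL (1G + A + W) ≡ true →
              ∃[ v ] (U 𝒰 v × leftWinsR v ≡ false) × leftWinsR (1G + A + v) ≡ true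
      build (W , uW , lostW , wonW) =
        answer m W ,
        (U-form 𝒰 (λ ()) (λ ()) (tally∈U m ∷ []) (uW ∷ []) , losesR-move (answer m W) (here refl) lostW) ,
        answer-winsR (1G + A) m W (<⇒≤ (<-≤-trans (height-R (1G + Kᴸ) my) h)) wonW

    refute : ¬ (∃[ Vs ] All (λ v → U 𝒰 v × leftWinsR v ≡ false) Vs ×
                (∀ {y} → y ∈ Ropts (1G + Kᴸ) → ∃[ v ] v ∈ Vs × leftWinsR (y + v) ≡ true))
    refute (Vs , good , answers) = contradiction (trans (sym wonX) lostX) λ ()
      where
      X = probe m Vs
      uX : U 𝒰 X
      uX = U-form 𝒰 (λ ()) (λ ()) (1∈U ∷ All.map proj₁ good) (tally∈U m ∷ [])
      lostX : leftWinsL X ≡ false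
      lostX = probe-losesL m Vs (All.map proj₂ good)
      wonX : leftWinsL X ≡ true
      wonX = trans (sym (proj₁ (leftWins-0+ X)))
        (≥ₒ-leftWinsL (0G + X) (1G + K + X) (≤0 X uX)
          (winsL-move (1G + K + X) (+-Lˡ (1G + K) X (+-Lʳ 1G K mL)) (probe-winsR (1G + Kᴸ) m Vs h answers)))

  mutual
    1+≤0⇒winsL-1̄ : ∀ K X → Acc _<_ (height K +ℕ height X) → 0G ≥[ U 𝒰 ] (1G + K) → U 𝒰 X →
      leftWinsL (K + X) ≡ true → leftWinsL (1̄ + X) ≡ true
    1+≤0⇒winsL-1̄ K X (acc rec) ≤0 uX wins with winsL⁻ (K + X) wins
    ... | inj₁ end = winsL-end (1̄ + X) (+-LeftEnd 1̄ X refl (+-LeftEnd⁻ʳ K X end))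
    ... | inj₂ (_ , mw , won) with +-L⁻ K X mw
    ...   | inʳ {Xᴸ} mL =
      winsL-move (1̄ + X) (+-Lʳ 1̄ X mL)
        (1+≤0⇒winsR-1̄ K Xᴸ (rec (+-monoʳ-< (height K) (height-L X mL))) ≤0 (U-optL 𝒰 uX mL) won)
    ...   | inˡ {Kᴸ} mL = decidable-stable (leftWinsL (1̄ + X) ≟ true) (¬¬-map continue (1+≤0-reversible K ≤0 mL))
      where
      continue : ∃[ A ] A ∈ Ropts Kᴸ × 0G ≥[ U 𝒰 ] (1G + A) → leftWinsL (1̄ + X) ≡ true
      continue (A , mA , ≤0A) =
        1+≤0⇒winsL-1̄ A X (rec (+-monoˡ-< (height X) (<-trans (height-R Kᴸ mA) (height-L K mL)))) ≤0A uX
          (winsR⁻ (Kᴸ + X) won (+-Rˡ Kᴸ X mA))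

    1+≤0⇒winsR-1̄ : ∀ K X → Acc _<_ (height K +ℕ height X) → 0G ≥[ U 𝒰 ] (1G + K) → U 𝒰 X →
      leftWinsR (K + X) ≡ true → leftWinsR (1̄ + X) ≡ true
    1+≤0⇒winsR-1̄ K X (acc rec) ≤0 uX wins =
      winsR (1̄ + X) (∈⇒NonEmpty (+-Rˡ 1̄ X (here refl))) λ mw → reply (+-R⁻ 1̄ X mw)
      where
      reply : ∀ {w} → SumOption 1̄ X (0G ∷ []) (Ropts X) w → leftWinsL w ≡ true
      reply (inˡ (here refl)) =
        ≥ₒ-leftWinsL (0G + X) (1G + K + X) (≤0 X uX)
          (winsL-move (1G + K + X) (+-Lˡ (1G + K) X (+-Lˡ 1G K (here refl)))
            (subst (λ K′ → leftWinsR (K′ + X) ≡ true) (sym (+-identityˡ K)) wins))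
      reply (inʳ {Xᴿ} mR) =
        1+≤0⇒winsL-1̄ K Xᴿ (rec (+-monoʳ-< (height K) (height-R X mR))) ≤0 (U-optR 𝒰 uX mR)
          (winsR⁻ (K + X) wins (+-Rʳ K X mR))

  1+≤0⇒losesL-vs-disintegrator : ∀ K D → 0G ≥[ U 𝒰 ] (1G + K) → U 𝒰 D → LeftEnd D → Disintegrator D →
    ¬ leftWinsL (1G + K + D) ≡ true
  1+≤0⇒losesL-vs-disintegrator K D ≤0 uD endD dis = go K (<-wellFounded _) ≤0
    where
    go : ∀ K → Acc _<_ (height K) → 0G ≥[ U 𝒰 ] (1G + K) → ¬ leftWinsL (1G + K + D) ≡ true
    go K (acc rec) ≤0 wins with winsL⁻ (1G + K + D) wins
    ... | inj₁ end = ∈⇒NonEmpty (+-Lˡ (1G + K) D (+-Lˡ 1G K (here refl))) end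
    ... | inj₂ (_ , mw , won) with +-L⁻ (1G + K) D mw
    ...   | inʳ mD = ∈⇒NonEmpty mD endD
    ...   | inˡ mK with +-L⁻ 1G K mK
    ...     | inˡ (here refl)
      with () ← trans (sym (1+≤0⇒winsR-1̄ K D (<-wellFounded _) ≤0 uD
                               (subst (λ K′ → leftWinsR (K′ + D) ≡ true) (+-identityˡ K) won)))
                      (disintegrator-losesR-1̄ dis)
    ...     | inʳ {Kᴸ} mL = 1+≤0-reversible K ≤0 mL λ (A , mA , ≤0A) →
      go A (rec (<-trans (height-R Kᴸ mA) (height-L K mL))) ≤0A
        (winsR⁻ (1G + Kᴸ + D) won (+-Rˡ (1G + Kᴸ) D (+-Rʳ 1G Kᴸ mA)))

  necessity : Invertible 𝒰 1G → ∀ G → U 𝒰 G → LeftEnd G → ¬ Disintegrator G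
  necessity (H , _ , ≥0 , ≤0) G uG end dis =
    1+≤0⇒losesL-vs-disintegrator H G ≤0 uG end dis
      (≥ₒ-leftWinsL (1G + H + G) (0G + G) (≥0 G uG) (winsL-end (0G + G) (+-LeftEnd 0G G refl end)))

-- 1 carries no tombstones, so its only expansion is 1 itself.
1∈U : ∀ 𝒰 → Uhat 𝒰 (plain 1G) → U 𝒰 1G
1∈U 𝒰 (_ , expand (expand [] [] refl refl ∷ []) [] refl refl , u) = u

proposition4p6 : (𝒰 : Universe) → Uhat 𝒰 (plain 1G) →
    (Invertible 𝒰 1G ⇔ (∀ G → U 𝒰 G → LeftEnd G → ¬ Disintegrator G))
proposition4p6 𝒰 1̂ =
  mk⇔ (Necessity.necessity 𝒰 (1∈U 𝒰 1̂))
      (λ noDisintegrator → 1̄ , U-conj 𝒰 (1∈U 𝒰 1̂) , Sufficiency.1+1̄≡0 𝒰 noDisintegrator)
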